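{- Let $M\to_{lor}N$ where the left-most outer-most redex of $M$ is $RQ$. Suppose $\Gamma_1\vdash N:\delta_1\mid\Delta_1$ with $\delta_1$ not an intersection type, and $\Gamma_2\vdash Q:\delta_2\mid\Delta_2$. Then there exist a basis $\Gamma_3$, a name context $\Delta_3$ and a term type $\delta_3$ such that $\Gamma_3\le\Gamma_1$, $\Delta_3\le\Delta_1$, $\delta_1\le\delta_3$, and $\Gamma_3\vdash M:\delta_3\mid\Delta_3$.
   Context: Pure $\lambda\mu$-calculus: terms $M,N ::= x \mid \lambda x.M \mid MN \mid \mu\alpha.C$, commands $C ::= [\alpha]M$, over disjoint denumerable sets of term variables and names; $\lambda$ binds $x$, $\mu$ binds $\alpha$; bound and free variables/names kept distinct. Structural substitution $T[\alpha\Leftarrow L]$ replaces every subcommand $[\alpha]P$ of $T$ by $[\alpha](P[\alpha\Leftarrow L])L$ and commutes with other constructs. Redexes are subterms $(\lambda x.P)Q$ (contracting to $P[Q/x]$) and $(\mu\alpha.[\beta]P)Q$ (contracting to $\mu\alpha.(([\beta]P)[\alpha\Leftarrow Q])$). An occurrence of a redex $R_0$ in $M$ is the left-most outer-most redex of $M$ if no redex occurrence in $M$ properly contains it and there is no redex $R'$ with $M=C_0[C_1[R']\,C_2[R_0]]$ for contexts $C_0,C_1,C_2$; $M\to_{lor}N$ means $N$ is obtained by contracting the left-most outer-most redex of $M$. Types: with a single constant $\nu$ and a symbol $\omega$ (not itself a type), term types $\delta ::= \nu \mid \omega\to\nu \mid \kappa\to\nu \mid \delta\wedge\delta$ and stack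 types $\kappa ::= \delta\times\omega \mid \delta\times\kappa \mid \kappa\wedge\kappa$. The preorder $\le$ is the least preorder with: $\sigma\wedge\tau\le\sigma$; $\sigma\wedge\tau\le\tau$; $\nu\le\omega\to\nu$; $\omega\to\nu\le\nu$; $\delta_1\times\delta_2\times\omega\le\delta_1\times\omega$; $(\delta_1\times\omega)\wedge(\delta_2\times\kappa)\le(\delta_1\wedge\delta_2)\times\kappa$; $(\delta_1\times\kappa_1)\wedge(\delta_2\times\kappa_2)\le(\delta_1\wedge\delta_2)\times(\kappa_1\wedge\kappa_2)$; $\delta_1\le\delta_2\Rightarrow\delta_1\times\omega\le\delta_2\times\omega$; $\delta_1\le\delta_2,\kappa_1\le\kappa_2\Rightarrow\delta_1\times\kappa_1\le\delta_2\times\kappa_2$; $\sigma\le\tau_1,\sigma\le\tau_2\Rightarrow\sigma\le\tau_1\wedge\tau_2$; $\kappa_2\le\kappa_1\Rightarrow\kappa_1\to\nu\le\kappa_2\to\nu$. Bases $\Gamma$ map finitely many term variables to term types; name contexts $\Delta$ map finitely many names to stack types; comma = disjoint extension. $\Gamma'\le\Gamma$ iff for every $x{:}\delta\in\Gamma$ there is $x{:}\delta'\in\Gamma'$ with $\delta'\le\delta$; likewise for name contexts. Typing rules: (ax) $\Gamma,x{:}\delta\vdash x:\delta\mid\Delta$; (abs) from $\Gamma,x{:}\delta\vdash M:\kappa\to\nu\mid\Delta$ infer $\Gamma\vdash\lambda x.M:\delta\times\kappa\to\nu\mid\Delta$; (app) from $\Gamma\vdash M:\delta\times\kappa\to\nu\mid\Delta$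 and $\Gamma\vdash N:\delta\mid\Delta$ infer $\Gamma\vdash MN:\kappa\to\nu\mid\Delta$ ($\kappa$ a stack type or $\omega$ in (abs), (app)); ($\mu$) from $\Gamma\vdash M:\kappa\to\nu\mid\alpha{:}\kappa,\Delta$ infer $\Gamma\vdash\mu\alpha.[\alpha]M:\kappa\to\nu\mid\Delta$, and for $\alpha\ne\beta$ from $\Gamma\vdash M:\kappa'\to\nu\mid\alpha{:}\kappa,\beta{:}\kappa',\Delta$ infer $\Gamma\vdash\mu\alpha.[\beta]M:\kappa\to\nu\mid\beta{:}\kappa',\Delta$; ($\le$) from $\Gamma\vdash M:\delta\mid\Delta$ and $\delta\le\delta'$ infer $\Gamma\vdash M:\delta'\mid\Delta$; ($\wedge$) from $\Gamma\vdash M:\delta\mid\Delta$ and $\Gamma\vdash M:\delta'\mid\Delta$ infer $\Gamma\vdash M:\delta\wedge\delta'\mid\Delta$. Variables in $\Gamma$ and names in $\Delta$ are not bound in the typed term. -}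

module Defs where

open import Data.Nat using (ℕ; zero; suc; _≟_)
open import Data.List using (List; []; _∷_)
open import Data.Maybe using (Maybe; just; nothing)
open import Data.Product using (Σ; ∃; _×_; _,_)
open import Relation.Nullary using (¬_; yes; no)
open import Relation.Binary.PropositionalEquality using (_≡_)

-- Pure λμ-terms, in de Bruijn notation (terms up to α-conversion).
-- Term variables and names are two disjoint sorts of de Bruijn indices:
-- λ binds term-variable index 0, μ binds name index 0.

mutual
  data Term : Set where
    var : ℕ → Term
    lam : Term → Term
    app : Term → Term → Term
    mu  : Command → Term

  data Command : Set where
    [_]_ : ℕ → Term → Command

extR : (ℕ → ℕ) → ℕ → ℕ
extR ρ zero    = zero
extR ρ (suc i) = suc (ρ i)

mutual
  renV : (ℕ → ℕ) → Term → Term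
  renV ρ (var x)   = var (ρ x)
  renV ρ (lam M)   = lam (renV (extR ρ) M)
  renV ρ (app M N) = app (renV ρ M) (renV ρ N)
  renV ρ (mu c)    = mu (renVC ρ c)

  renVC : (ℕ → ℕ) → Command → Command
  renVC ρ ([ a ] M) = [ a ] renV ρ M

mutual
  renN : (ℕ → ℕ) → Term → Term
  renN ρ (var x)   = var x
  renN ρ (lam M)   = lam (renN ρ M)
  renN ρ (app M N) = app (renN ρ M) (renN ρ N)
  renN ρ (mu c)    = mu (renNC (extR ρ) c)

  renNC : (ℕ → ℕ) → Command → Command
  renNC ρ ([ a ] M) = [ ρ a ] renN ρ M

extS : (ℕ → Term) → ℕ → Term
extS σ zero    = var zero
extS σ (suc i) = renV suc (σ i)

mutual
  sub : (ℕ → Term) → Term → Term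
  sub σ (var x)   = σ x
  sub σ (lam M)   = lam (sub (extS σ) M)
  sub σ (app M N) = app (sub σ M) (sub σ N)
  sub σ (mu c)    = mu (subC (λ i → renN suc (σ i)) c)

  subC : (ℕ → Term) → Command → Command
  subC σ ([ a ] M) = [ a ] sub σ M

single : Term → ℕ → Term
single Q zero    = Q
single Q (suc i) = var i

_[_/0] : Term → Term → Term
P [ Q /0] = sub (single Q) P

-- structural substitution T[α ⇐ L]: α is the name index a, L is already
-- expressed in the scope of T
mutual
  ssub : ℕ → Term → Term → Term
  ssub a L (var x)   = var x
  ssub a L (lam M)   = lam (ssub a (renV suc L) M)
  ssub a L (app M N) = app (ssub a L M) (ssub a L N)
  ssub a L (mu c)    = mu (ssubC (suc a) (renN suc L) c)

  ssubC : ℕ → Term → Command → Command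
  ssubC a L ([ b ] M) with b ≟ a
  ... | yes _ = [ b ] app (ssub a L M) L
  ... | no  _ = [ b ] ssub a L M

data IsRedex : Term → Set where
  β-redex : ∀ P Q → IsRedex (app (lam P) Q)
  μ-redex : ∀ C Q → IsRedex (app (mu C) Q)

data _▷_ : Term → Term → Set where
  β-contr : ∀ P Q → app (lam P) Q ▷ (P [ Q /0])
  -- (μα.[β]P)Q  →  μα.(([β]P)[α ⇐ Q]); α is name 0 inside, Q is weakened
  μ-contr : ∀ C Q → app (mu C) Q ▷ mu (ssubC zero (renN suc Q) C)

-- One-hole term contexts; an occurrence of a subterm R in M is a context
-- C with plug C R ≡ M.

data Ctx : Set where
  hole : Ctx
  lamC : Ctx → Ctx
  appL : Ctx → Term → Ctx
  appR : Term → Ctx → Ctx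
  muC  : ℕ → Ctx → Ctx

plug : Ctx → Term → Term
plug hole       R = R
plug (lamC C)   R = lam (plug C R)
plug (appL C N) R = app (plug C R) N
plug (appR M C) R = app M (plug C R)
plug (muC b C)  R = mu ([ b ] plug C R)

_∘C_ : Ctx → Ctx → Ctx
hole     ∘C D = D
lamC C   ∘C D = lamC (C ∘C D)
appL C N ∘C D = appL (C ∘C D) N
appR M C ∘C D = appR M (C ∘C D)
muC b C  ∘C D = muC b (C ∘C D)

record LeftmostOutermost (M : Term) (C : Ctx) (R0 : Term) : Set where
  field
    occurs   : plug C R0 ≡ M
    isRedex  : IsRedex R0
    -- no redex occurrence in M properly contains this occurrence
    outermost : ¬ (Σ Ctx λ C' → Σ Ctx λ D →
                    ¬ (D ≡ hole) × (C ≡ (C' ∘C D)) × IsRedex (plug D R0))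
    -- there is no redex R' with M = C0[C1[R'] C2[R0]] (this occurrence of R0)
    leftmost : ¬ (Σ Ctx λ C0 → Σ Ctx λ C1 → Σ Ctx λ C2 → Σ Term λ R' →
                    IsRedex R' × (C ≡ (C0 ∘C appR (plug C1 R') C2)))

record _→lor_ (M N : Term) : Set where
  field
    ctx        : Ctx
    redex      : Term
    contractum : Term
    isLOR      : LeftmostOutermost M ctx redex
    contracts  : redex ▷ contractum
    result     : N ≡ plug ctx contractum


mutual
  data TType : Set where
    ν    : TType
    ω⇒ν  : TType
    _⇒ν  : SType → TType
    _∧_  : TType → TType → TType

  data SType : Set where
    _×ω  : TType → SType
    _⊗_  : TType → SType → SType
    _∧s_ : SType → SType → SType

infixr 5 _⊗_
infixl 4 _∧_ _∧s_

data StackOrΩ : Set where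
  isω   : StackOrΩ
  stack : SType → StackOrΩ

arr : StackOrΩ → TType
arr isω       = ω⇒ν
arr (stack κ) = κ ⇒ν

cons : TType → StackOrΩ → SType
cons δ isω       = δ ×ω
cons δ (stack κ) = δ ⊗ κ

mutual
  data _≤t_ : TType → TType → Set where
    t-refl  : ∀ {δ} → δ ≤t δ
    t-trans : ∀ {δ₁ δ₂ δ₃} → δ₁ ≤t δ₂ → δ₂ ≤t δ₃ → δ₁ ≤t δ₃
    t-∧l    : ∀ {σ τ} → (σ ∧ τ) ≤t σ
    t-∧r    : ∀ {σ τ} → (σ ∧ τ) ≤t τ
    t-νω    : ν ≤t ω⇒ν
    t-ων    : ω⇒ν ≤t ν
    t-∧I    : ∀ {σ τ₁ τ₂} → σ ≤t τ₁ → σ ≤t τ₂ → σ ≤t (τ₁ ∧ τ₂)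
    t-arr   : ∀ {κ₁ κ₂} → κ₂ ≤s κ₁ → (κ₁ ⇒ν) ≤t (κ₂ ⇒ν)

  data _≤s_ : SType → SType → Set where
    s-refl  : ∀ {κ} → κ ≤s κ
    s-trans : ∀ {κ₁ κ₂ κ₃} → κ₁ ≤s κ₂ → κ₂ ≤s κ₃ → κ₁ ≤s κ₃
    s-∧l    : ∀ {σ τ} → (σ ∧s τ) ≤s σ
    s-∧r    : ∀ {σ τ} → (σ ∧s τ) ≤s τ
    s-drop  : ∀ {δ₁ δ₂} → (δ₁ ⊗ (δ₂ ×ω)) ≤s (δ₁ ×ω)
    s-∧ω    : ∀ {δ₁ δ₂ κ} → ((δ₁ ×ω) ∧s (δ₂ ⊗ κ)) ≤s ((δ₁ ∧ δ₂) ⊗ κ)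
    s-∧×    : ∀ {δ₁ δ₂ κ₁ κ₂} →
              ((δ₁ ⊗ κ₁) ∧s (δ₂ ⊗ κ₂)) ≤s ((δ₁ ∧ δ₂) ⊗ (κ₁ ∧s κ₂))
    s-monoω : ∀ {δ₁ δ₂} → δ₁ ≤t δ₂ → (δ₁ ×ω) ≤s (δ₂ ×ω)
    s-mono  : ∀ {δ₁ δ₂ κ₁ κ₂} → δ₁ ≤t δ₂ → κ₁ ≤s κ₂ → (δ₁ ⊗ κ₁) ≤s (δ₂ ⊗ κ₂)
    s-∧I    : ∀ {σ τ₁ τ₂} → σ ≤s τ₁ → σ ≤s τ₂ → σ ≤s (τ₁ ∧s τ₂)

-- Bases and name contexts: finite maps from de Bruijn indices, as lists
-- (entry i describes index i; nothing / out of range = not in domain).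

Basis : Set
Basis = List (Maybe TType)

NameCtx : Set
NameCtx = List (Maybe SType)

lookupM : {A : Set} → List (Maybe A) → ℕ → Maybe A
lookupM []       _       = nothing
lookupM (e ∷ _)  zero    = e
lookupM (_ ∷ es) (suc i) = lookupM es i

_≤Γ_ : Basis → Basis → Set
Γ' ≤Γ Γ = ∀ i δ → lookupM Γ i ≡ just δ →
            ∃ λ δ' → (lookupM Γ' i ≡ just δ') × (δ' ≤t δ)

_≤Δ_ : NameCtx → NameCtx → Set
Δ' ≤Δ Δ = ∀ a κ → lookupM Δ a ≡ just κ →
            ∃ λ κ' → (lookupM Δ' a ≡ just κ') × (κ' ≤s κ)

data _⊢_∶_∣_ : Basis → Term → TType → NameCtx → Set where
  ax   : ∀ {Γ Δ x δ} → lookupM Γ x ≡ just δ → Γ ⊢ var x ∶ δ ∣ Δ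
  abs  : ∀ {Γ Δ M δ} (k : StackOrΩ) →
         (just δ ∷ Γ) ⊢ M ∶ arr k ∣ Δ →
         Γ ⊢ lam M ∶ (cons δ k ⇒ν) ∣ Δ
  appT : ∀ {Γ Δ M N δ} (k : StackOrΩ) →
         Γ ⊢ M ∶ (cons δ k ⇒ν) ∣ Δ → Γ ⊢ N ∶ δ ∣ Δ →
         Γ ⊢ app M N ∶ arr k ∣ Δ
  μ-same : ∀ {Γ Δ M κ} →
         Γ ⊢ M ∶ (κ ⇒ν) ∣ (just κ ∷ Δ) →
         Γ ⊢ mu ([ zero ] M) ∶ (κ ⇒ν) ∣ Δ
  -- μα.[β]M, β ≠ α  (β is name b outside, suc b under the binder)
  μ-other : ∀ {Γ Δ M κ κ' b} →
         lookupM Δ b ≡ just κ' →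
         Γ ⊢ M ∶ (κ' ⇒ν) ∣ (just κ ∷ Δ) →
         Γ ⊢ mu ([ suc b ] M) ∶ (κ ⇒ν) ∣ Δ
  sub≤ : ∀ {Γ Δ M δ δ'} → Γ ⊢ M ∶ δ ∣ Δ → δ ≤t δ' → Γ ⊢ M ∶ δ' ∣ Δ
  ∧I   : ∀ {Γ Δ M δ δ'} → Γ ⊢ M ∶ δ ∣ Δ → Γ ⊢ M ∶ δ' ∣ Δ →
         Γ ⊢ M ∶ (δ ∧ δ') ∣ Δ

NotIntersection : TType → Set
NotIntersection δ = ¬ (Σ TType λ a → Σ TType λ b → δ ≡ (a ∧ b))

-- A typing of the reduct is pulled back in two steps. Locally, a typing of the contractum
-- P[Q/x] or μα.([β]P)[α ⇐ Q] splits into a typing of P and typings of the copies of Q it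
-- contains; intersecting the types of these copies (and of Q itself, which covers the case of
-- no copies) types the redex at the same type. The typing is then transported outwards along
-- the context of the redex. Below binders the bases may shrink, which can only relax the
-- arrow types of enclosing abstractions (δ ⊑ δ'); under an application this would break the
-- application rule, but for the left-most outer-most redex the hole is never the body of an
-- applied abstraction, and everything to its left is a neutral term, which can be retyped at
-- any arrow type by strengthening the type of its head variable. The rules (≤) and (∧) are
-- handled once and for all: a property of types closed under ≤ and ∧ that holds for the
-- syntax-directed typings of a term holds for all of its typings.

module Submission where

open import Data.Empty using (⊥-elim)
open import Data.List using (List; []; _∷_)
open import Data.Maybe using (Maybe; just; nothing)
open import Data.Maybe.Properties using (just-injective)
open import Data.Nat using (ℕ; zero; suc)
open import Data.Nat.Properties using (_≟_)
open import Data.Product using (Σ; ∃; _×_; _,_)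
open import Relation.Nullary using (¬_; Dec; yes; no)
open import Relation.Binary.PropositionalEquality
  using (_≡_; _≢_; refl; sym; trans; cong; cong₂; subst)

open import Defs

module _ {A : Set} where

  Every : (ℕ → A → Set) → List (Maybe A) → Set
  Every P Γ = ∀ i a → lookupM Γ i ≡ just a → P i a

  Renaming : (ℕ → ℕ) → List (Maybe A) → List (Maybe A) → Set
  Renaming ρ Γ Γ' = ∀ i a → lookupM Γ i ≡ just a → lookupM Γ' (ρ i) ≡ just a

  Renaming⁻¹ : (ℕ → ℕ) → List (Maybe A) → List (Maybe A) → Set
  Renaming⁻¹ ρ Γ Γ* = ∀ i a → lookupM Γ (ρ i) ≡ just a → lookupM Γ* i ≡ just a

  Renaming-ext : ∀ {ρ Γ Γ'} a → Renaming ρ Γ Γ' → Renaming (extR ρ) (just a ∷ Γ) (just a ∷ Γ')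
  Renaming-ext a p zero    b e = e
  Renaming-ext a p (suc i) b e = p i b e

  Renaming⁻¹-ext : ∀ {ρ Γ Γ*} a → Renaming⁻¹ ρ Γ Γ* → Renaming⁻¹ (extR ρ) (just a ∷ Γ) (just a ∷ Γ*)
  Renaming⁻¹-ext a p zero    b e = e
  Renaming⁻¹-ext a p (suc i) b e = p i b e

  update : List (Maybe A) → ℕ → Maybe A → List (Maybe A)
  update []       zero    v = v ∷ []
  update []       (suc i) v = nothing ∷ update [] i v
  update (_ ∷ Γ)  zero    v = v ∷ Γ
  update (m ∷ Γ)  (suc i) v = m ∷ update Γ i v

  lookup-update-≡ : ∀ Γ i v → lookupM (update Γ i v) i ≡ v
  lookup-update-≡ []      zero    v = refl
  lookup-update-≡ []      (suc i) v = lookup-update-≡ [] i v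
  lookup-update-≡ (_ ∷ Γ) zero    v = refl
  lookup-update-≡ (_ ∷ Γ) (suc i) v = lookup-update-≡ Γ i v

  lookup-update-≢ : ∀ Γ {i j} v → j ≢ i → lookupM (update Γ i v) j ≡ lookupM Γ j
  lookup-update-≢ Γ       {zero}  {zero}  v j≢i = ⊥-elim (j≢i refl)
  lookup-update-≢ []      {zero}  {suc j} v j≢i = refl
  lookup-update-≢ (_ ∷ Γ) {zero}  {suc j} v j≢i = refl
  lookup-update-≢ []      {suc i} {zero}  v j≢i = refl
  lookup-update-≢ (_ ∷ Γ) {suc i} {zero}  v j≢i = refl
  lookup-update-≢ []      {suc i} {suc j} v j≢i = lookup-update-≢ [] v (λ e → j≢i (cong suc e))
  lookup-update-≢ (_ ∷ Γ) {suc i} {suc j} v j≢i = lookup-update-≢ Γ v (λ e → j≢i (cong suc e))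

  Every-singleton : ∀ {P} i {a} → P i a → Every P (update [] i (just a))
  Every-singleton zero    p zero    _ refl = p
  Every-singleton zero    p (suc j) _ ()
  Every-singleton (suc i) p zero    _ ()
  Every-singleton {P} (suc i) p (suc j) = Every-singleton {λ j → P (suc j)} i p j

module ContextOrder {A : Set} (_≼_ : A → A → Set)
  (≼-refl : ∀ {a} → a ≼ a) (≼-trans : ∀ {a b c} → a ≼ b → b ≼ c → a ≼ c)
  (_∧_ : A → A → A) (∧-≼ˡ : ∀ {a b} → (a ∧ b) ≼ a) (∧-≼ʳ : ∀ {a b} → (a ∧ b) ≼ b) where

  record _≤_ (Γ' Γ : List (Maybe A)) : Set where
    constructor pointwise
    field
      lookup-≤ : ∀ i a → lookupM Γ i ≡ just a → ∃ λ a' → (lookupM Γ' i ≡ just a') × (a' ≼ a)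
  open _≤_ public

  ≤-refl : ∀ {Γ} → Γ ≤ Γ
  ≤-refl = pointwise λ i a e → a , e , ≼-refl

  ≤-trans : ∀ {Γ₁ Γ₂ Γ₃} → Γ₁ ≤ Γ₂ → Γ₂ ≤ Γ₃ → Γ₁ ≤ Γ₃
  ≤-trans p q = pointwise λ i a e →
    let a₂ , e₂ , a₂≼a = lookup-≤ q i a e
        a₁ , e₁ , a₁≼a₂ = lookup-≤ p i a₂ e₂
    in a₁ , e₁ , ≼-trans a₁≼a₂ a₂≼a

  ≤-∷⁺ : ∀ {Γ' Γ x y} → x ≼ y → Γ' ≤ Γ → (just x ∷ Γ') ≤ (just y ∷ Γ)
  ≤-∷⁺ x≼y p = pointwise λ where
    zero    _ refl → _ , refl , x≼y
    (suc i) a e    → lookup-≤ p i a e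

  ≤-∷⁻ : ∀ {Γ' Γ y} → Γ' ≤ (just y ∷ Γ) →
         ∃ λ x → ∃ λ Γ'' → (Γ' ≡ just x ∷ Γ'') × (x ≼ y) × (Γ'' ≤ Γ)
  ≤-∷⁻ {[]} p with lookup-≤ p zero _ refl
  ... | _ , () , _
  ≤-∷⁻ {_ ∷ Γ''} p with lookup-≤ p zero _ refl
  ... | x , refl , x≼y = x , Γ'' , refl , x≼y , pointwise (λ i → lookup-≤ p (suc i))

  update-≤ : ∀ Γ i {a a'} → lookupM Γ i ≡ just a → a' ≼ a → update Γ i (just a') ≤ Γ
  update-≤ Γ i {a} {a'} la a'≼a = pointwise go
    where
    go : ∀ j b → lookupM Γ j ≡ just b → ∃ λ b' → (lookupM (update Γ i (just a')) j ≡ just b') × (b' ≼ b)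
    go j b e with j ≟ i
    ... | yes refl = a' , lookup-update-≡ Γ i _ , subst (a' ≼_) (just-injective (trans (sym la) e)) a'≼a
    ... | no j≢i   = b , trans (lookup-update-≢ Γ _ j≢i) e , ≼-refl

  update-mono : ∀ Γ i {a b} → a ≼ b → update Γ i (just a) ≤ update Γ i (just b)
  update-mono Γ i {a} {b} a≼b = pointwise go
    where
    go : ∀ j c → lookupM (update Γ i (just b)) j ≡ just c →
         ∃ λ c' → (lookupM (update Γ i (just a)) j ≡ just c') × (c' ≼ c)
    go j c e with j ≟ i
    ... | yes refl = a , lookup-update-≡ Γ i _ ,
                     subst (a ≼_) (just-injective (trans (sym (lookup-update-≡ Γ i _)) e)) a≼b
    ... | no j≢i   = c , trans (lookup-update-≢ Γ _ j≢i) (trans (sym (lookup-update-≢ Γ _ j≢i)) e) , ≼-refl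

  _⊓ₘ_ : Maybe A → Maybe A → Maybe A
  just a  ⊓ₘ just b  = just (a ∧ b)
  just a  ⊓ₘ nothing = just a
  nothing ⊓ₘ y       = y

  _⊓_ : List (Maybe A) → List (Maybe A) → List (Maybe A)
  []       ⊓ ys       = ys
  (x ∷ xs) ⊓ []       = x ∷ xs
  (x ∷ xs) ⊓ (y ∷ ys) = (x ⊓ₘ y) ∷ (xs ⊓ ys)

  ⊓-≤ˡ : ∀ xs ys → (xs ⊓ ys) ≤ xs
  ⊓-≤ˡ xs ys = pointwise (go xs ys)
    where
    go : ∀ xs ys i a → lookupM xs i ≡ just a → ∃ λ a' → (lookupM (xs ⊓ ys) i ≡ just a') × (a' ≼ a)
    go []             ys             i       a ()
    go (x ∷ xs)       []             i       a e    = a , e , ≼-refl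
    go (just _ ∷ xs)  (just _ ∷ ys)  zero    _ refl = _ , refl , ∧-≼ˡ
    go (just _ ∷ xs)  (nothing ∷ ys) zero    _ refl = _ , refl , ≼-refl
    go (nothing ∷ xs) (y ∷ ys)       zero    _ ()
    go (x ∷ xs)       (y ∷ ys)       (suc i) = go xs ys i

  ⊓-≤ʳ : ∀ xs ys → (xs ⊓ ys) ≤ ys
  ⊓-≤ʳ xs ys = pointwise (go xs ys)
    where
    go : ∀ xs ys i a → lookupM ys i ≡ just a → ∃ λ a' → (lookupM (xs ⊓ ys) i ≡ just a') × (a' ≼ a)
    go []             ys             i       a e    = a , e , ≼-refl
    go (x ∷ xs)       []             i       a ()
    go (just _ ∷ xs)  (just _ ∷ ys)  zero    _ refl = _ , refl , ∧-≼ʳ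
    go (just _ ∷ xs)  (nothing ∷ ys) zero    _ ()
    go (nothing ∷ xs) (y ∷ ys)       zero    _ e    = _ , e , ≼-refl
    go (x ∷ xs)       (y ∷ ys)       (suc i) = go xs ys i

  Every-⊓ : ∀ {P : ℕ → A → Set} → (∀ {i a b} → P i a → P i b → P i (a ∧ b)) →
            ∀ xs ys → Every P xs → Every P ys → Every P (xs ⊓ ys)
  Every-⊓ P-∧ []             ys             px py = py
  Every-⊓ P-∧ (x ∷ xs)       []             px py = px
  Every-⊓ P-∧ (just a ∷ xs)  (just b ∷ ys)  px py zero _ refl = P-∧ (px zero a refl) (py zero b refl)
  Every-⊓ P-∧ (just a ∷ xs)  (nothing ∷ ys) px py zero _ refl = px zero a refl
  Every-⊓ P-∧ (nothing ∷ xs) (y ∷ ys)       px py zero = py zero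
  Every-⊓ {P} P-∧ (x ∷ xs) (y ∷ ys) px py (suc i) =
    Every-⊓ {λ i → P (suc i)} P-∧ xs ys (λ i → px (suc i)) (λ i → py (suc i)) i

module Γ≤ = ContextOrder _≤t_ t-refl t-trans _∧_ t-∧l t-∧r
module Δ≤ = ContextOrder _≤s_ s-refl s-trans _∧s_ s-∧l s-∧r
open Γ≤ using () renaming (_≤_ to _≤ᴮ_; _⊓_ to _⊓ᴮ_)
open Δ≤ using () renaming (_≤_ to _≤ᴺ_; _⊓_ to _⊓ᴺ_)

data _⇒∈_ : SType → TType → Set where
  here : ∀ {κ} → κ ⇒∈ (κ ⇒ν)
  ∧ˡ   : ∀ {κ σ τ} → κ ⇒∈ σ → κ ⇒∈ (σ ∧ τ)
  ∧ʳ   : ∀ {κ σ τ} → κ ⇒∈ τ → κ ⇒∈ (σ ∧ τ)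

⇒∈-≤ : ∀ {κ δ} → κ ⇒∈ δ → δ ≤t (κ ⇒ν)
⇒∈-≤ here   = t-refl
⇒∈-≤ (∧ˡ p) = t-trans t-∧l (⇒∈-≤ p)
⇒∈-≤ (∧ʳ p) = t-trans t-∧r (⇒∈-≤ p)

≤-⇒∈ : ∀ {δ τ κ} → δ ≤t τ → κ ⇒∈ τ → ∃ λ κ' → (κ' ⇒∈ δ) × (κ ≤s κ')
≤-⇒∈ t-refl        p      = _ , p , s-refl
≤-⇒∈ (t-trans r q) p      with ≤-⇒∈ q p
... | κ₂ , p₂ , κ≤κ₂ with ≤-⇒∈ r p₂
... | κ₁ , p₁ , κ₂≤κ₁ = κ₁ , p₁ , s-trans κ≤κ₂ κ₂≤κ₁
≤-⇒∈ t-∧l          p      = _ , ∧ˡ p , s-refl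
≤-⇒∈ t-∧r          p      = _ , ∧ʳ p , s-refl
≤-⇒∈ (t-∧I r q)    (∧ˡ p) = ≤-⇒∈ r p
≤-⇒∈ (t-∧I r q)    (∧ʳ p) = ≤-⇒∈ q p
≤-⇒∈ (t-arr κ₂≤κ₁) here   = _ , here , κ₂≤κ₁

data _⊑_ : TType → TType → Set where
  ν⊑ : ν ⊑ ν
  ω⊑ : ω⇒ν ⊑ ω⇒ν
  κ⊑ : ∀ {κ κ'} → κ' ≤s κ → (κ ⇒ν) ⊑ (κ' ⇒ν)
  ∧⊑ : ∀ {σ σ' τ τ'} → σ ⊑ σ' → τ ⊑ τ' → (σ ∧ τ) ⊑ (σ' ∧ τ')

⊑-refl : ∀ δ → δ ⊑ δ
⊑-refl ν       = ν⊑
⊑-refl ω⇒ν     = ω⊑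
⊑-refl (κ ⇒ν)  = κ⊑ s-refl
⊑-refl (σ ∧ τ) = ∧⊑ (⊑-refl σ) (⊑-refl τ)

⊑⇒≤ : ∀ {δ δ'} → δ ⊑ δ' → δ ≤t δ'
⊑⇒≤ ν⊑        = t-refl
⊑⇒≤ ω⊑        = t-refl
⊑⇒≤ (κ⊑ r)    = t-arr r
⊑⇒≤ (∧⊑ p q)  = t-∧I (t-trans t-∧l (⊑⇒≤ p)) (t-trans t-∧r (⊑⇒≤ q))

≤-⊑-square : ∀ {δ τ δ'} → δ ≤t τ → δ ⊑ δ' → ∃ λ τ' → (τ ⊑ τ') × (δ' ≤t τ')
≤-⊑-square t-refl        p        = _ , p , t-refl
≤-⊑-square (t-trans r q) p        with ≤-⊑-square r p
... | _ , p' , r' with ≤-⊑-square q p'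
... | τ' , p'' , q' = τ' , p'' , t-trans r' q'
≤-⊑-square t-∧l          (∧⊑ p q) = _ , p , t-∧l
≤-⊑-square t-∧r          (∧⊑ p q) = _ , q , t-∧r
≤-⊑-square t-νω          ν⊑       = _ , ω⊑ , t-νω
≤-⊑-square t-ων          ω⊑       = _ , ν⊑ , t-ων
≤-⊑-square (t-∧I r q)    p        with ≤-⊑-square r p | ≤-⊑-square q p
... | τ₁ , p₁ , r₁ | τ₂ , p₂ , r₂ = (τ₁ ∧ τ₂) , ∧⊑ p₁ p₂ , t-∧I r₁ r₂
≤-⊑-square (t-arr {κ₂ = κ₂} r) (κ⊑ {κ' = κ₁'} r') = (κ₂ ∧s κ₁') ⇒ν , κ⊑ s-∧l , t-arr s-∧r

arr-⊑ : ∀ k {δ} → arr k ⊑ δ →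
        ∃ λ k' → (δ ≡ arr k') × (∀ {σ τ} → σ ≤t τ → cons σ k' ≤s cons τ k)
arr-⊑ isω       ω⊑     = isω , refl , s-monoω
arr-⊑ (stack κ) (κ⊑ r) = stack _ , refl , λ σ≤τ → s-mono σ≤τ r

record Filter (P : TType → Set) : Set where
  field
    ≤-closed : ∀ {δ δ'} → P δ → δ ≤t δ' → P δ'
    ∧-closed : ∀ {δ δ'} → P δ → P δ' → P (δ ∧ δ')
open Filter

⊢-filter : ∀ {Γ M Δ} → Filter (λ δ → Γ ⊢ M ∶ δ ∣ Δ)
⊢-filter = record { ≤-closed = sub≤ ; ∧-closed = ∧I }

const-filter : ∀ {A : Set} → Filter (λ _ → A)
const-filter = record { ≤-closed = λ a _ → a ; ∧-closed = λ a _ → a }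

⊢-var-inv : ∀ {Γ Δ x τ} → Γ ⊢ var x ∶ τ ∣ Δ → ∃ λ σ → (lookupM Γ x ≡ just σ) × (σ ≤t τ)
⊢-var-inv (ax e)     = _ , e , t-refl
⊢-var-inv (sub≤ d r) with ⊢-var-inv d
... | σ , e , σ≤ = σ , e , t-trans σ≤ r
⊢-var-inv (∧I d₁ d₂) with ⊢-var-inv d₁ | ⊢-var-inv d₂
... | σ , e₁ , σ≤₁ | σ' , e₂ , σ'≤₂ with trans (sym e₁) e₂
... | refl = σ , e₁ , t-∧I σ≤₁ σ'≤₂

module _ {P : TType → Set} (F : Filter P) {Γ : Basis} {Δ : NameCtx} where

  ⊢-lam-elim : ∀ {M δ} → (∀ {δx} k → (just δx ∷ Γ) ⊢ M ∶ arr k ∣ Δ → P (cons δx k ⇒ν)) →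
               Γ ⊢ lam M ∶ δ ∣ Δ → P δ
  ⊢-lam-elim h (abs k d)  = h k d
  ⊢-lam-elim h (sub≤ d r) = ≤-closed F (⊢-lam-elim h d) r
  ⊢-lam-elim h (∧I d₁ d₂) = ∧-closed F (⊢-lam-elim h d₁) (⊢-lam-elim h d₂)

  ⊢-app-elim : ∀ {M N δ} → (∀ {δN} k → Γ ⊢ M ∶ cons δN k ⇒ν ∣ Δ → Γ ⊢ N ∶ δN ∣ Δ → P (arr k)) →
               Γ ⊢ app M N ∶ δ ∣ Δ → P δ
  ⊢-app-elim h (appT k d₁ d₂) = h k d₁ d₂
  ⊢-app-elim h (sub≤ d r)     = ≤-closed F (⊢-app-elim h d) r
  ⊢-app-elim h (∧I d₁ d₂)     = ∧-closed F (⊢-app-elim h d₁) (⊢-app-elim h d₂)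

  ⊢-μ-same-elim : ∀ {M δ} → (∀ {κ} → Γ ⊢ M ∶ κ ⇒ν ∣ (just κ ∷ Δ) → P (κ ⇒ν)) →
                  Γ ⊢ mu ([ zero ] M) ∶ δ ∣ Δ → P δ
  ⊢-μ-same-elim h (μ-same d) = h d
  ⊢-μ-same-elim h (sub≤ d r) = ≤-closed F (⊢-μ-same-elim h d) r
  ⊢-μ-same-elim h (∧I d₁ d₂) = ∧-closed F (⊢-μ-same-elim h d₁) (⊢-μ-same-elim h d₂)

  ⊢-μ-other-elim : ∀ {b M δ} →
                   (∀ {κ κ'} → lookupM Δ b ≡ just κ' → Γ ⊢ M ∶ κ' ⇒ν ∣ (just κ ∷ Δ) → P (κ ⇒ν)) →
                   Γ ⊢ mu ([ suc b ] M) ∶ δ ∣ Δ → P δ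
  ⊢-μ-other-elim h (μ-other e d) = h e d
  ⊢-μ-other-elim h (sub≤ d r)    = ≤-closed F (⊢-μ-other-elim h d) r
  ⊢-μ-other-elim h (∧I d₁ d₂)    = ∧-closed F (⊢-μ-other-elim h d₁) (⊢-μ-other-elim h d₂)

⊢-app-inv : ∀ {Γ Δ M N δ} → Γ ⊢ app M N ∶ δ ∣ Δ →
            (∃ λ τ → Γ ⊢ M ∶ τ ∣ Δ) × (∃ λ δN → Γ ⊢ N ∶ δN ∣ Δ)
⊢-app-inv = ⊢-app-elim const-filter λ k d₁ d₂ → (_ , d₁) , (_ , d₂)

⊢-app-inv-⇒ : ∀ {Γ Δ M N τ κ} → Γ ⊢ app M N ∶ τ ∣ Δ → τ ≤t (κ ⇒ν) →
              ∃ λ δN → (Γ ⊢ M ∶ (δN ⊗ κ) ⇒ν ∣ Δ) × (Γ ⊢ N ∶ δN ∣ Δ)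
⊢-app-inv-⇒ (appT isω d₁ d₂) r with ≤-⇒∈ r here
... | _ , () , _
⊢-app-inv-⇒ (appT (stack κ) d₁ d₂) r with ≤-⇒∈ r here
... | _ , here , κ'≤κ = _ , sub≤ d₁ (t-arr (s-mono t-refl κ'≤κ)) , d₂
⊢-app-inv-⇒ (sub≤ d r') r = ⊢-app-inv-⇒ d (t-trans r' r)
⊢-app-inv-⇒ (∧I d₁ d₂) r with ≤-⇒∈ r here
... | _ , ∧ˡ p , κ≤ = ⊢-app-inv-⇒ d₁ (t-trans (⇒∈-≤ p) (t-arr κ≤))
... | _ , ∧ʳ p , κ≤ = ⊢-app-inv-⇒ d₂ (t-trans (⇒∈-≤ p) (t-arr κ≤))

weaken : ∀ {Γ Γ' Δ Δ' M δ} → Γ' ≤ᴮ Γ → Δ' ≤ᴺ Δ → Γ ⊢ M ∶ δ ∣ Δ → Γ' ⊢ M ∶ δ ∣ Δ'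
weaken pΓ pΔ (ax e) with Γ≤.lookup-≤ pΓ _ _ e
... | _ , e' , r = sub≤ (ax e') r
weaken pΓ pΔ (abs k d)      = abs k (weaken (Γ≤.≤-∷⁺ t-refl pΓ) pΔ d)
weaken pΓ pΔ (appT k d₁ d₂) = appT k (weaken pΓ pΔ d₁) (weaken pΓ pΔ d₂)
weaken pΓ pΔ (μ-same d)     = μ-same (weaken pΓ (Δ≤.≤-∷⁺ s-refl pΔ) d)
weaken pΓ pΔ (μ-other e d) with Δ≤.lookup-≤ pΔ _ _ e
... | _ , e' , r = μ-other e' (sub≤ (weaken pΓ (Δ≤.≤-∷⁺ s-refl pΔ) d) (t-arr r))
weaken pΓ pΔ (sub≤ d r)     = sub≤ (weaken pΓ pΔ d) r
weaken pΓ pΔ (∧I d₁ d₂)     = ∧I (weaken pΓ pΔ d₁) (weaken pΓ pΔ d₂)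

weakenᴮ : ∀ {Γ Γ' Δ M δ} → Γ' ≤ᴮ Γ → Γ ⊢ M ∶ δ ∣ Δ → Γ' ⊢ M ∶ δ ∣ Δ
weakenᴮ p = weaken p Δ≤.≤-refl

weakenᴺ : ∀ {Γ Δ Δ' M δ} → Δ' ≤ᴺ Δ → Γ ⊢ M ∶ δ ∣ Δ → Γ ⊢ M ∶ δ ∣ Δ'
weakenᴺ p = weaken Γ≤.≤-refl p

⊢-renV : ∀ {ρ Γ Γ' Δ M δ} → Renaming ρ Γ Γ' → Γ ⊢ M ∶ δ ∣ Δ → Γ' ⊢ renV ρ M ∶ δ ∣ Δ
⊢-renV p (ax e)         = ax (p _ _ e)
⊢-renV p (abs k d)      = abs k (⊢-renV (Renaming-ext _ p) d)
⊢-renV p (appT k d₁ d₂) = appT k (⊢-renV p d₁) (⊢-renV p d₂)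
⊢-renV p (μ-same d)     = μ-same (⊢-renV p d)
⊢-renV p (μ-other e d)  = μ-other e (⊢-renV p d)
⊢-renV p (sub≤ d r)     = sub≤ (⊢-renV p d) r
⊢-renV p (∧I d₁ d₂)     = ∧I (⊢-renV p d₁) (⊢-renV p d₂)

⊢-renN : ∀ {ρ Γ Δ Δ' M δ} → Renaming ρ Δ Δ' → Γ ⊢ M ∶ δ ∣ Δ → Γ ⊢ renN ρ M ∶ δ ∣ Δ'
⊢-renN p (ax e)         = ax e
⊢-renN p (abs k d)      = abs k (⊢-renN p d)
⊢-renN p (appT k d₁ d₂) = appT k (⊢-renN p d₁) (⊢-renN p d₂)
⊢-renN p (μ-same d)     = μ-same (⊢-renN (Renaming-ext _ p) d)
⊢-renN p (μ-other e d)  = μ-other (p _ _ e) (⊢-renN (Renaming-ext _ p) d)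
⊢-renN p (sub≤ d r)     = sub≤ (⊢-renN p d) r
⊢-renN p (∧I d₁ d₂)     = ∧I (⊢-renN p d₁) (⊢-renN p d₂)

⊢-renV⁻¹ : ∀ M {ρ Γ Γ* Δ δ} → Renaming⁻¹ ρ Γ Γ* → Γ ⊢ renV ρ M ∶ δ ∣ Δ → Γ* ⊢ M ∶ δ ∣ Δ
⊢-renV⁻¹ (var x) p d with ⊢-var-inv d
... | _ , e , r = sub≤ (ax (p _ _ e)) r
⊢-renV⁻¹ (lam M) p =
  ⊢-lam-elim ⊢-filter λ k d → abs k (⊢-renV⁻¹ M (Renaming⁻¹-ext _ p) d)
⊢-renV⁻¹ (app M N) p =
  ⊢-app-elim ⊢-filter λ k d₁ d₂ → appT k (⊢-renV⁻¹ M p d₁) (⊢-renV⁻¹ N p d₂)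
⊢-renV⁻¹ (mu ([ zero ] M)) p =
  ⊢-μ-same-elim ⊢-filter λ d → μ-same (⊢-renV⁻¹ M p d)
⊢-renV⁻¹ (mu ([ suc b ] M)) p =
  ⊢-μ-other-elim ⊢-filter λ e d → μ-other e (⊢-renV⁻¹ M p d)

⊢-renN⁻¹ : ∀ M {ρ Γ Δ Δ* δ} → Renaming⁻¹ ρ Δ Δ* → Γ ⊢ renN ρ M ∶ δ ∣ Δ → Γ ⊢ M ∶ δ ∣ Δ*
⊢-renN⁻¹ (var x) p d with ⊢-var-inv d
... | _ , e , r = sub≤ (ax e) r
⊢-renN⁻¹ (lam M) p =
  ⊢-lam-elim ⊢-filter λ k d → abs k (⊢-renN⁻¹ M p d)
⊢-renN⁻¹ (app M N) p =
  ⊢-app-elim ⊢-filter λ k d₁ d₂ → appT k (⊢-renN⁻¹ M p d₁) (⊢-renN⁻¹ N p d₂)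
⊢-renN⁻¹ (mu ([ zero ] M)) p =
  ⊢-μ-same-elim ⊢-filter λ d → μ-same (⊢-renN⁻¹ M (Renaming⁻¹-ext _ p) d)
⊢-renN⁻¹ (mu ([ suc b ] M)) p =
  ⊢-μ-other-elim ⊢-filter λ e d → μ-other (p _ _ e) (⊢-renN⁻¹ M (Renaming⁻¹-ext _ p) d)

⊢-shiftV : ∀ {Γ Δ M δ m} → Γ ⊢ M ∶ δ ∣ Δ → (m ∷ Γ) ⊢ renV suc M ∶ δ ∣ Δ
⊢-shiftV = ⊢-renV λ _ _ e → e

⊢-shiftN : ∀ {Γ Δ M δ m} → Γ ⊢ M ∶ δ ∣ Δ → Γ ⊢ renN suc M ∶ δ ∣ (m ∷ Δ)
⊢-shiftN = ⊢-renN λ _ _ e → e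

⊢-unshiftV : ∀ {Γ Δ M δ m} → (m ∷ Γ) ⊢ renV suc M ∶ δ ∣ Δ → Γ ⊢ M ∶ δ ∣ Δ
⊢-unshiftV {M = M} = ⊢-renV⁻¹ M λ _ _ e → e

⊢-unshiftN : ∀ {Γ Δ M δ m} → Γ ⊢ renN suc M ∶ δ ∣ (m ∷ Δ) → Γ ⊢ M ∶ δ ∣ Δ
⊢-unshiftN {M = M} = ⊢-renN⁻¹ M λ _ _ e → e

data Neutral : Term → Set where
  var : ∀ {x} → Neutral (var x)
  app : ∀ {M N} → Neutral M → Neutral (app M N)

Neutral-retype : ∀ {M Γ Δ τ} → Neutral M → Γ ⊢ M ∶ τ ∣ Δ → ∀ k →
                 ∃ λ Γ' → (Γ' ≤ᴮ Γ) × (Γ' ⊢ M ∶ arr k ∣ Δ)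
Neutral-retype {var x} {Γ} var d k with ⊢-var-inv d
... | σ , e , _ = update Γ x (just (σ ∧ arr k)) , Γ≤.update-≤ Γ x e t-∧l ,
                  sub≤ (ax (lookup-update-≡ Γ x _)) t-∧r
Neutral-retype (app n) d k with ⊢-app-inv d
... | (_ , ⊢M) , (δN , ⊢N) with Neutral-retype n ⊢M (stack (cons δN k))
... | Γ' , Γ'≤Γ , ⊢M' = Γ' , Γ'≤Γ , appT k ⊢M' (weakenᴮ Γ'≤Γ ⊢N)

-- Expanding the contractum of a redex

_⊢ˢ_∶_∣_ : Basis → (ℕ → Term) → Basis → NameCtx → Set
Γ ⊢ˢ σ ∶ Γ₀ ∣ Δ = Every (λ i τ → Γ ⊢ σ i ∶ τ ∣ Δ) Γ₀

SubstExpansion : Term → (ℕ → Term) → Basis → NameCtx → TType → Set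
SubstExpansion P σ Γ Δ δ = ∃ λ Γ₀ → (Γ₀ ⊢ P ∶ δ ∣ Δ) × (Γ ⊢ˢ σ ∶ Γ₀ ∣ Δ)

SubstExpansion-⊓ : ∀ {P P' σ Γ Δ δ δ'} → SubstExpansion P σ Γ Δ δ → SubstExpansion P' σ Γ Δ δ' →
                   ∃ λ Γ₀ → (Γ₀ ⊢ P ∶ δ ∣ Δ) × (Γ₀ ⊢ P' ∶ δ' ∣ Δ) × (Γ ⊢ˢ σ ∶ Γ₀ ∣ Δ)
SubstExpansion-⊓ {σ = σ} {Γ} {Δ} (Γ₁ , ⊢P , ⊢σ₁) (Γ₂ , ⊢P' , ⊢σ₂) =
  Γ₁ ⊓ᴮ Γ₂ , weakenᴮ (Γ≤.⊓-≤ˡ Γ₁ Γ₂) ⊢P , weakenᴮ (Γ≤.⊓-≤ʳ Γ₁ Γ₂) ⊢P' ,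
  Γ≤.Every-⊓ {P = λ i τ → Γ ⊢ σ i ∶ τ ∣ Δ} ∧I Γ₁ Γ₂ ⊢σ₁ ⊢σ₂

SubstExpansion-filter : ∀ {P σ Γ Δ} → Filter (SubstExpansion P σ Γ Δ)
SubstExpansion-filter = record
  { ≤-closed = λ (Γ₀ , ⊢P , ⊢σ) r → Γ₀ , sub≤ ⊢P r , ⊢σ
  ; ∧-closed = λ e₁ e₂ → let Γ₀ , ⊢P₁ , ⊢P₂ , ⊢σ = SubstExpansion-⊓ e₁ e₂ in Γ₀ , ∧I ⊢P₁ ⊢P₂ , ⊢σ
  }

⊢ˢ-extS⁻ : ∀ {σ Γ Δ δ Γ₀'} → (just δ ∷ Γ) ⊢ˢ extS σ ∶ Γ₀' ∣ Δ →
           ∃ λ Γ₀ → ((just δ ∷ Γ₀) ≤ᴮ Γ₀') × (Γ ⊢ˢ σ ∶ Γ₀ ∣ Δ)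
⊢ˢ-extS⁻ {Γ₀' = []}     ⊢σ = [] , Γ≤.pointwise (λ _ _ ()) , (λ _ _ ())
⊢ˢ-extS⁻ {Γ₀' = _ ∷ Γ₀} ⊢σ = Γ₀ , Γ≤.pointwise head-≤ , λ i τ e → ⊢-unshiftV (⊢σ (suc i) τ e)
  where
  head-≤ : ∀ i τ → lookupM (_ ∷ Γ₀) i ≡ just τ → ∃ λ τ' → (lookupM (just _ ∷ Γ₀) i ≡ just τ') × (τ' ≤t τ)
  head-≤ zero    τ e with ⊢-var-inv (⊢σ zero τ e)
  ... | _ , refl , r = _ , refl , r
  head-≤ (suc i) τ e = τ , e , t-refl

⊢-sub-expand : ∀ P σ {Γ Δ δ} → Γ ⊢ sub σ P ∶ δ ∣ Δ → SubstExpansion P σ Γ Δ δ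
⊢-sub-expand (var x) σ {δ = δ} ⊢σx =
  update [] x (just δ) , ax (lookup-update-≡ [] x _) , Every-singleton x ⊢σx
⊢-sub-expand (lam M) σ = ⊢-lam-elim SubstExpansion-filter λ k ⊢M →
  let Γ₀' , ⊢M' , ⊢σ' = ⊢-sub-expand M (extS σ) ⊢M
      Γ₀ , Γ₀≤ , ⊢σ = ⊢ˢ-extS⁻ ⊢σ'
  in Γ₀ , abs k (weakenᴮ Γ₀≤ ⊢M') , ⊢σ
⊢-sub-expand (app M N) σ = ⊢-app-elim SubstExpansion-filter λ k ⊢M ⊢N →
  let Γ₀ , ⊢M' , ⊢N' , ⊢σ = SubstExpansion-⊓ (⊢-sub-expand M σ ⊢M) (⊢-sub-expand N σ ⊢N)
  in Γ₀ , appT k ⊢M' ⊢N' , ⊢σ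
⊢-sub-expand (mu ([ zero ] M)) σ = ⊢-μ-same-elim SubstExpansion-filter λ ⊢M →
  let Γ₀ , ⊢M' , ⊢σ = ⊢-sub-expand M _ ⊢M
  in Γ₀ , μ-same ⊢M' , λ i τ e → ⊢-unshiftN (⊢σ i τ e)
⊢-sub-expand (mu ([ suc b ] M)) σ = ⊢-μ-other-elim SubstExpansion-filter λ lb ⊢M →
  let Γ₀ , ⊢M' , ⊢σ = ⊢-sub-expand M _ ⊢M
  in Γ₀ , μ-other lb ⊢M' , λ i τ e → ⊢-unshiftN (⊢σ i τ e)

⊢ˢ-single⁻ : ∀ {Q Γ Δ Γ₀ δQ} → Γ ⊢ˢ single Q ∶ Γ₀ ∣ Δ → Γ ⊢ Q ∶ δQ ∣ Δ →
             ∃ λ δ → ((just δ ∷ Γ) ≤ᴮ Γ₀) × (Γ ⊢ Q ∶ δ ∣ Δ)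
⊢ˢ-single⁻ {Γ₀ = []}           ⊢σ ⊢Q = _ , Γ≤.pointwise (λ _ _ ()) , ⊢Q
⊢ˢ-single⁻ {Γ₀ = nothing ∷ Γ₀} ⊢σ ⊢Q = _ , Γ≤.pointwise tail-≤ , ⊢Q
  where
  tail-≤ : ∀ i τ → lookupM (nothing ∷ Γ₀) i ≡ just τ → ∃ λ τ' → (lookupM (just _ ∷ _) i ≡ just τ') × (τ' ≤t τ)
  tail-≤ (suc i) τ e = ⊢-var-inv (⊢σ (suc i) τ e)
⊢ˢ-single⁻ {Γ₀ = just δ ∷ Γ₀}  ⊢σ ⊢Q = δ , Γ≤.pointwise tail-≤ , ⊢σ zero δ refl
  where
  tail-≤ : ∀ i τ → lookupM (just δ ∷ Γ₀) i ≡ just τ → ∃ λ τ' → (lookupM (just δ ∷ _) i ≡ just τ') × (τ' ≤t τ)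
  tail-≤ zero    τ e = τ , e , t-refl
  tail-≤ (suc i) τ e = ⊢-var-inv (⊢σ (suc i) τ e)

⊢-app-lam : ∀ δ {P Q Γ Δ δQ} → (just δQ ∷ Γ) ⊢ P ∶ δ ∣ Δ → Γ ⊢ Q ∶ δQ ∣ Δ →
            Γ ⊢ app (lam P) Q ∶ δ ∣ Δ
⊢-app-lam ν       ⊢P ⊢Q = sub≤ (appT isω (abs isω (sub≤ ⊢P t-νω)) ⊢Q) t-ων
⊢-app-lam ω⇒ν     ⊢P ⊢Q = appT isω (abs isω ⊢P) ⊢Q
⊢-app-lam (κ ⇒ν)  ⊢P ⊢Q = appT (stack κ) (abs (stack κ) ⊢P) ⊢Q
⊢-app-lam (σ ∧ τ) ⊢P ⊢Q = ∧I (⊢-app-lam σ (sub≤ ⊢P t-∧l) ⊢Q) (⊢-app-lam τ (sub≤ ⊢P t-∧r) ⊢Q)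

-- Q must be typable on its own: P may not use the bound variable.
⊢-β-expand : ∀ P Q {Γ Δ δ δQ} → Γ ⊢ P [ Q /0] ∶ δ ∣ Δ → Γ ⊢ Q ∶ δQ ∣ Δ →
             Γ ⊢ app (lam P) Q ∶ δ ∣ Δ
⊢-β-expand P Q {δ = δ} ⊢PQ ⊢Q =
  let Γ₀ , ⊢P , ⊢σ = ⊢-sub-expand P (single Q) ⊢PQ
      _ , Γ≤Γ₀ , ⊢Q' = ⊢ˢ-single⁻ ⊢σ ⊢Q
  in ⊢-app-lam δ (weakenᴮ Γ≤Γ₀ ⊢P) ⊢Q'

StructExpansion : Term → ℕ → Term → Basis → NameCtx → SType → TType → Set
StructExpansion T a L Γ Δ κ δ =
  ∃ λ δL → (Γ ⊢ L ∶ δL ∣ Δ) × (Γ ⊢ T ∶ δ ∣ update Δ a (just (δL ⊗ κ)))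

StructExpansion-⊓ : ∀ {T T' a L Γ Δ κ δ δ'} →
  StructExpansion T a L Γ Δ κ δ → StructExpansion T' a L Γ Δ κ δ' →
  ∃ λ δL → (Γ ⊢ L ∶ δL ∣ Δ) × (Γ ⊢ T ∶ δ ∣ update Δ a (just (δL ⊗ κ)))
                             × (Γ ⊢ T' ∶ δ' ∣ update Δ a (just (δL ⊗ κ)))
StructExpansion-⊓ {a = a} {Δ = Δ} (δ₁ , ⊢L₁ , ⊢T) (δ₂ , ⊢L₂ , ⊢T') =
  (δ₁ ∧ δ₂) , ∧I ⊢L₁ ⊢L₂ ,
  weakenᴺ (Δ≤.update-mono Δ a (s-mono t-∧l s-refl)) ⊢T ,
  weakenᴺ (Δ≤.update-mono Δ a (s-mono t-∧r s-refl)) ⊢T'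

StructExpansion-filter : ∀ {T a L Γ Δ κ} → Filter (StructExpansion T a L Γ Δ κ)
StructExpansion-filter = record
  { ≤-closed = λ (δL , ⊢L , ⊢T) r → δL , ⊢L , sub≤ ⊢T r
  ; ∧-closed = λ e₁ e₂ → let δL , ⊢L , ⊢T₁ , ⊢T₂ = StructExpansion-⊓ e₁ e₂ in δL , ⊢L , ∧I ⊢T₁ ⊢T₂
  }

⊢-ssub-expand : ∀ T {a L Γ Δ κ δ δL} → lookupM Δ a ≡ just κ → Γ ⊢ L ∶ δL ∣ Δ →
                Γ ⊢ ssub a L T ∶ δ ∣ Δ → StructExpansion T a L Γ Δ κ δ
⊢-ssub-expand (var x) la ⊢L ⊢x with ⊢-var-inv ⊢x
... | _ , e , r = _ , ⊢L , sub≤ (ax e) r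
⊢-ssub-expand (lam M) la ⊢L = ⊢-lam-elim StructExpansion-filter λ k ⊢M →
  let δL , ⊢L' , ⊢M' = ⊢-ssub-expand M la (⊢-shiftV ⊢L) ⊢M
  in δL , ⊢-unshiftV ⊢L' , abs k ⊢M'
⊢-ssub-expand (app M N) la ⊢L = ⊢-app-elim StructExpansion-filter λ k ⊢M ⊢N →
  let δL , ⊢L' , ⊢M' , ⊢N' = StructExpansion-⊓ (⊢-ssub-expand M la ⊢L ⊢M) (⊢-ssub-expand N la ⊢L ⊢N)
  in δL , ⊢L' , appT k ⊢M' ⊢N'
⊢-ssub-expand (mu ([ b ] M)) {a} {L} {Γ} {Δ} {κ} {δ} la ⊢L ⊢T with b ≟ suc a
... | yes refl = ⊢-μ-other-elim StructExpansion-filter named ⊢T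
  where
  -- the new argument L is typed together with the copies of L already inside M
  named : ∀ {κα κ'} → lookupM Δ a ≡ just κ' →
          Γ ⊢ app (ssub (suc a) (renN suc L) M) (renN suc L) ∶ κ' ⇒ν ∣ (just κα ∷ Δ) →
          StructExpansion (mu ([ suc a ] M)) a L Γ Δ κ (κα ⇒ν)
  named {κα} la' ⊢ML with trans (sym la) la'
  ... | refl with ⊢-app-inv-⇒ ⊢ML t-refl
  ... | δ₁ , ⊢M , ⊢L₁ with ⊢-ssub-expand M la ⊢L₁ ⊢M
  ... | δ₂ , ⊢L₂ , ⊢M' =
    (δ₂ ∧ δ₁) , ∧I (⊢-unshiftN ⊢L₂) (⊢-unshiftN ⊢L₁) ,
    μ-other (lookup-update-≡ Δ a _)
      (sub≤ (weakenᴺ (Δ≤.update-mono (just κα ∷ Δ) (suc a) (s-mono t-∧l s-refl)) ⊢M')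
            (t-arr (s-mono t-∧r s-refl)))
... | no b≢sa = other b b≢sa ⊢T
  where
  other : ∀ b → b ≢ suc a → Γ ⊢ mu ([ b ] ssub (suc a) (renN suc L) M) ∶ δ ∣ Δ →
          StructExpansion (mu ([ b ] M)) a L Γ Δ κ δ
  other zero    _ = ⊢-μ-same-elim StructExpansion-filter λ ⊢M →
    let δL , ⊢L' , ⊢M' = ⊢-ssub-expand M la (⊢-shiftN ⊢L) ⊢M
    in δL , ⊢-unshiftN ⊢L' , μ-same ⊢M'
  other (suc b) b≢a = ⊢-μ-other-elim StructExpansion-filter λ lb ⊢M →
    let δL , ⊢L' , ⊢M' = ⊢-ssub-expand M la (⊢-shiftN ⊢L) ⊢M
    in δL , ⊢-unshiftN ⊢L' , μ-other (trans (lookup-update-≢ Δ _ (λ e → b≢a (cong suc e))) lb) ⊢M'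

⊢-μ-expand : ∀ C Q {Γ Δ δ δQ} → Γ ⊢ mu (ssubC zero (renN suc Q) C) ∶ δ ∣ Δ → Γ ⊢ Q ∶ δQ ∣ Δ →
             Γ ⊢ app (mu C) Q ∶ δ ∣ Δ
⊢-μ-expand ([ zero ] M) Q ⊢N _ = ⊢-μ-same-elim ⊢-filter (λ {κ} ⊢MQ →
  let δ₁ , ⊢M , ⊢Q₁ = ⊢-app-inv-⇒ ⊢MQ t-refl
      δ₂ , ⊢Q₂ , ⊢M' = ⊢-ssub-expand M refl ⊢Q₁ ⊢M
  in appT (stack κ)
       (μ-same (sub≤ (weakenᴺ (Δ≤.≤-∷⁺ (s-mono t-∧l s-refl) Δ≤.≤-refl) ⊢M') (t-arr (s-mono t-∧r s-refl))))
       (∧I (⊢-unshiftN ⊢Q₂) (⊢-unshiftN ⊢Q₁))) ⊢N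
⊢-μ-expand ([ suc b ] M) Q ⊢N ⊢Q = ⊢-μ-other-elim ⊢-filter (λ {κ} lb ⊢M →
  let δL , ⊢Q' , ⊢M' = ⊢-ssub-expand M refl (⊢-shiftN ⊢Q) ⊢M
  in appT (stack κ) (μ-other lb ⊢M') (⊢-unshiftN ⊢Q')) ⊢N

ExpandsTo : Term → Term → Set
ExpandsTo N₀ X = ∀ {Γ Δ δ} → Γ ⊢ N₀ ∶ δ ∣ Δ →
  ∃ λ Γ' → ∃ λ Δ' → (Γ' ≤ᴮ Γ) × (Δ' ≤ᴺ Δ) × (Γ' ⊢ X ∶ δ ∣ Δ')

⊢-redex-expand : ∀ {R Q N₀ Γ₂ Δ₂ δ₂} → app R Q ▷ N₀ → Γ₂ ⊢ Q ∶ δ₂ ∣ Δ₂ → ExpandsTo N₀ (app R Q)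
⊢-redex-expand {Γ₂ = Γ₂} {Δ₂} contraction ⊢Q {Γ} {Δ} ⊢N₀ =
  Γ ⊓ᴮ Γ₂ , Δ ⊓ᴺ Δ₂ , Γ≤.⊓-≤ˡ Γ Γ₂ , Δ≤.⊓-≤ˡ Δ Δ₂ ,
  expand contraction (weaken (Γ≤.⊓-≤ˡ Γ Γ₂) (Δ≤.⊓-≤ˡ Δ Δ₂) ⊢N₀) (weaken (Γ≤.⊓-≤ʳ Γ Γ₂) (Δ≤.⊓-≤ʳ Δ Δ₂) ⊢Q)
  where
  expand : ∀ {R Q N₀ Γ Δ δ δQ} → app R Q ▷ N₀ → Γ ⊢ N₀ ∶ δ ∣ Δ → Γ ⊢ Q ∶ δQ ∣ Δ → Γ ⊢ app R Q ∶ δ ∣ Δ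
  expand (β-contr P Q) = ⊢-β-expand P Q
  expand (μ-contr C Q) = ⊢-μ-expand C Q

-- Expanding along the context of the redex

data IsAppCtx : Ctx → Set where
  hole : IsAppCtx hole
  appL : ∀ {C N} → IsAppCtx (appL C N)
  appR : ∀ {M C} → IsAppCtx (appR M C)

IsAppCtx? : ∀ C → Dec (IsAppCtx C)
IsAppCtx? hole       = yes hole
IsAppCtx? (lamC _)   = no λ ()
IsAppCtx? (appL _ _) = yes appL
IsAppCtx? (appR _ _) = yes appR
IsAppCtx? (muC _ _)  = no λ ()

-- Below a λ or μ the type may only be relaxed (the binder's type can shrink); in an
-- application context it must be kept exactly, as it feeds an application rule.
record Expansion (X : Term) (C : Ctx) (Γ : Basis) (Δ : NameCtx) (δ : TType) : Set where
  constructor expansion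
  field
    Γ'    : Basis
    Δ'    : NameCtx
    δ'    : TType
    Γ'≤Γ  : Γ' ≤ᴮ Γ
    Δ'≤Δ  : Δ' ≤ᴺ Δ
    δ⊑δ'  : δ ⊑ δ'
    exact : IsAppCtx C → δ' ≡ δ
    ⊢plug : Γ' ⊢ plug C X ∶ δ' ∣ Δ'

module _ {X : Term} where

  exact-expansion : ∀ {C Γ Δ Γ' Δ' δ} → Γ' ≤ᴮ Γ → Δ' ≤ᴺ Δ → Γ' ⊢ plug C X ∶ δ ∣ Δ' → Expansion X C Γ Δ δ
  exact-expansion Γ'≤ Δ'≤ ⊢X = expansion _ _ _ Γ'≤ Δ'≤ (⊑-refl _) (λ _ → refl) ⊢X

  Expansion-≤ : ∀ C {Γ Δ δ τ} → Expansion X C Γ Δ δ → δ ≤t τ → Expansion X C Γ Δ τ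
  Expansion-≤ C (expansion Γ' Δ' δ' Γ'≤ Δ'≤ δ⊑δ' exact ⊢X) r with IsAppCtx? C
  ... | yes isApp with exact isApp
  ...   | refl = exact-expansion Γ'≤ Δ'≤ (sub≤ ⊢X r)
  Expansion-≤ C (expansion Γ' Δ' δ' Γ'≤ Δ'≤ δ⊑δ' exact ⊢X) r | no ¬isApp with ≤-⊑-square r δ⊑δ'
  ... | τ' , τ⊑τ' , δ'≤τ' = expansion Γ' Δ' τ' Γ'≤ Δ'≤ τ⊑τ' (λ isApp → ⊥-elim (¬isApp isApp)) (sub≤ ⊢X δ'≤τ')

  Expansion-∧ : ∀ C {Γ Δ δ₁ δ₂} → Expansion X C Γ Δ δ₁ → Expansion X C Γ Δ δ₂ → Expansion X C Γ Δ (δ₁ ∧ δ₂)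
  Expansion-∧ C (expansion Γ₁ Δ₁ δ₁' Γ₁≤ Δ₁≤ ⊑₁ exact₁ ⊢X₁) (expansion Γ₂ Δ₂ δ₂' Γ₂≤ Δ₂≤ ⊑₂ exact₂ ⊢X₂) =
    expansion (Γ₁ ⊓ᴮ Γ₂) (Δ₁ ⊓ᴺ Δ₂) (δ₁' ∧ δ₂')
      (Γ≤.≤-trans (Γ≤.⊓-≤ˡ Γ₁ Γ₂) Γ₁≤) (Δ≤.≤-trans (Δ≤.⊓-≤ˡ Δ₁ Δ₂) Δ₁≤) (∧⊑ ⊑₁ ⊑₂)
      (λ isApp → cong₂ _∧_ (exact₁ isApp) (exact₂ isApp))
      (∧I (weaken (Γ≤.⊓-≤ˡ Γ₁ Γ₂) (Δ≤.⊓-≤ˡ Δ₁ Δ₂) ⊢X₁) (weaken (Γ≤.⊓-≤ʳ Γ₁ Γ₂) (Δ≤.⊓-≤ʳ Δ₁ Δ₂) ⊢X₂))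

  Expansion-filter : ∀ C {Γ Δ} → Filter (Expansion X C Γ Δ)
  Expansion-filter C = record { ≤-closed = Expansion-≤ C ; ∧-closed = Expansion-∧ C }

  Expansion-lamC : ∀ {C Γ Δ δx} k → Expansion X C (just δx ∷ Γ) Δ (arr k) →
                   Expansion X (lamC C) Γ Δ (cons δx k ⇒ν)
  Expansion-lamC k (expansion _ Δ' _ Γ''≤ Δ'≤ arr⊑δ' _ ⊢X) with Γ≤.≤-∷⁻ Γ''≤ | arr-⊑ k arr⊑δ'
  ... | δx' , Γ' , refl , δx'≤δx , Γ'≤Γ | k' , refl , cons-mono =
    expansion Γ' Δ' (cons δx' k' ⇒ν) Γ'≤Γ Δ'≤ (κ⊑ (cons-mono δx'≤δx)) (λ ()) (abs k' ⊢X)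

  -- The name α is given the meet of its stack in the name context and in the body's type.
  Expansion-μ-same : ∀ {C Γ Δ κ} → Expansion X C Γ (just κ ∷ Δ) (κ ⇒ν) →
                     Expansion X (muC zero C) Γ Δ (κ ⇒ν)
  Expansion-μ-same (expansion Γ' _ _ Γ'≤ Δ''≤ (κ⊑ {κ' = κ'} _) _ ⊢X) with Δ≤.≤-∷⁻ Δ''≤
  ... | κ₁ , Δ' , refl , κ₁≤κ , Δ'≤Δ =
    expansion Γ' Δ' ((κ₁ ∧s κ') ⇒ν) Γ'≤ Δ'≤Δ (κ⊑ (s-trans s-∧l κ₁≤κ)) (λ ())
      (μ-same (sub≤ (weakenᴺ (Δ≤.≤-∷⁺ s-∧l Δ≤.≤-refl) ⊢X) (t-arr s-∧r)))

  Expansion-μ-other : ∀ {C Γ Δ b κ κ'} → lookupM Δ b ≡ just κ' → Expansion X C Γ (just κ ∷ Δ) (κ' ⇒ν) →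
                      Expansion X (muC (suc b) C) Γ Δ (κ ⇒ν)
  Expansion-μ-other {b = b} lb (expansion Γ' _ _ Γ'≤ Δ''≤ (κ⊑ {κ' = κ''} _) _ ⊢X) with Δ≤.≤-∷⁻ Δ''≤
  ... | κ₁ , Δ' , refl , κ₁≤κ , Δ'≤Δ with Δ≤.lookup-≤ Δ'≤Δ _ _ lb
  ... | κ₂ , lb' , _ =
    expansion Γ' (update Δ' b (just (κ₂ ∧s κ''))) (κ₁ ⇒ν) Γ'≤ (Δ≤.≤-trans Δ'≤Δ' Δ'≤Δ) (κ⊑ κ₁≤κ) (λ ())
      (μ-other (lookup-update-≡ Δ' b _) (sub≤ (weakenᴺ (Δ≤.≤-∷⁺ s-refl Δ'≤Δ') ⊢X) (t-arr s-∧r)))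
    where Δ'≤Δ' = Δ≤.update-≤ Δ' b lb' s-∧l

  Expansion-appL : ∀ {C N Γ Δ δ} k → IsAppCtx C → Expansion X C Γ Δ (cons δ k ⇒ν) → Γ ⊢ N ∶ δ ∣ Δ →
                   Expansion X (appL C N) Γ Δ (arr k)
  Expansion-appL k isApp (expansion _ _ _ Γ'≤ Δ'≤ _ exact ⊢X) ⊢N with exact isApp
  ... | refl = exact-expansion Γ'≤ Δ'≤ (appT k ⊢X (weaken Γ'≤ Δ'≤ ⊢N))

  -- The argument's type may have been relaxed to δ', so the neutral function is retyped to accept it.
  Expansion-appR : ∀ {M C Γ Δ δ} k → Neutral M → Γ ⊢ M ∶ cons δ k ⇒ν ∣ Δ → Expansion X C Γ Δ δ →
                   Expansion X (appR M C) Γ Δ (arr k)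
  Expansion-appR k n ⊢M (expansion _ _ δ' Γ'≤ Δ'≤ _ _ ⊢X)
    with Neutral-retype n (weaken Γ'≤ Δ'≤ ⊢M) (stack (cons δ' k))
  ... | _ , Γ''≤ , ⊢M' = exact-expansion (Γ≤.≤-trans Γ''≤ Γ'≤) Δ'≤ (appT k ⊢M' (weakenᴮ Γ''≤ ⊢X))

data LorCtx : Ctx → Set where
  hole : LorCtx hole
  lamC : ∀ {C} → LorCtx C → LorCtx (lamC C)
  muC  : ∀ {b C} → LorCtx C → LorCtx (muC b C)
  appL : ∀ {C N} → IsAppCtx C → LorCtx C → LorCtx (appL C N)
  appR : ∀ {M C} → Neutral M → LorCtx C → LorCtx (appR M C)

⊢-plug-expand : ∀ {N₀ X} → ExpandsTo N₀ X → ∀ {C} → LorCtx C →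
                ∀ {Γ Δ δ} → Γ ⊢ plug C N₀ ∶ δ ∣ Δ → Expansion X C Γ Δ δ
⊢-plug-expand expand hole ⊢N₀ =
  let Γ' , Δ' , Γ'≤ , Δ'≤ , ⊢X = expand ⊢N₀ in exact-expansion Γ'≤ Δ'≤ ⊢X
⊢-plug-expand expand (lamC c) = ⊢-lam-elim (Expansion-filter _) λ k ⊢M →
  Expansion-lamC k (⊢-plug-expand expand c ⊢M)
⊢-plug-expand expand (muC {zero} c) = ⊢-μ-same-elim (Expansion-filter _) λ ⊢M →
  Expansion-μ-same (⊢-plug-expand expand c ⊢M)
⊢-plug-expand expand (muC {suc b} c) = ⊢-μ-other-elim (Expansion-filter _) λ lb ⊢M →
  Expansion-μ-other lb (⊢-plug-expand expand c ⊢M)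
⊢-plug-expand expand (appL isApp c) = ⊢-app-elim (Expansion-filter _) λ k ⊢M ⊢N →
  Expansion-appL k isApp (⊢-plug-expand expand c ⊢M) ⊢N
⊢-plug-expand expand (appR n c) = ⊢-app-elim (Expansion-filter _) λ k ⊢M ⊢N →
  Expansion-appR k n ⊢M (⊢-plug-expand expand c ⊢N)

-- Contexts of left-most outer-most redexes

Outermost : Ctx → Term → Set
Outermost C R = ¬ (Σ Ctx λ C' → Σ Ctx λ D → ¬ (D ≡ hole) × (C ≡ (C' ∘C D)) × IsRedex (plug D R))

Leftmost : Ctx → Set
Leftmost C = ¬ (Σ Ctx λ C₀ → Σ Ctx λ C₁ → Σ Ctx λ C₂ → Σ Term λ R' →
                 IsRedex R' × (C ≡ (C₀ ∘C appR (plug C₁ R') C₂)))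

∘C-assoc : ∀ C D E → (C ∘C D) ∘C E ≡ C ∘C (D ∘C E)
∘C-assoc hole       D E = refl
∘C-assoc (lamC C)   D E = cong lamC (∘C-assoc C D E)
∘C-assoc (appL C N) D E = cong (λ C' → appL C' N) (∘C-assoc C D E)
∘C-assoc (appR M C) D E = cong (appR M) (∘C-assoc C D E)
∘C-assoc (muC b C)  D E = cong (muC b) (∘C-assoc C D E)

Outermost-∘ : ∀ E {C R} → Outermost (E ∘C C) R → Outermost C R
Outermost-∘ E om (C' , D , D≢hole , C≡ , r) =
  om (E ∘C C' , D , D≢hole , trans (cong (E ∘C_) C≡) (sym (∘C-assoc E C' D)) , r)

Leftmost-∘ : ∀ E {C} → Leftmost (E ∘C C) → Leftmost C
Leftmost-∘ E lm (C₀ , C₁ , C₂ , R' , r , C≡) =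
  lm (E ∘C C₀ , C₁ , C₂ , R' , r , trans (cong (E ∘C_) C≡) (sym (∘C-assoc E C₀ _)))

Outermost-appL : ∀ C {N R} → Outermost (appL C N) R → IsAppCtx C
Outermost-appL hole       om = hole
Outermost-appL (appL _ _) om = appL
Outermost-appL (appR _ _) om = appR
Outermost-appL (lamC C)  {N} om = ⊥-elim (om (hole , appL (lamC C) N , (λ ()) , refl , β-redex _ N))
Outermost-appL (muC b C) {N} om = ⊥-elim (om (hole , appL (muC b C) N , (λ ()) , refl , μ-redex _ N))

RedexFree : Term → Set
RedexFree M = ∀ C R → IsRedex R → plug C R ≢ M

RedexFree-app-Neutral : ∀ M N → RedexFree (app M N) → Neutral (app M N)
RedexFree-app-Neutral (var x)   N rf = app var
RedexFree-app-Neutral (lam P)   N rf = ⊥-elim (rf hole _ (β-redex P N) refl)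
RedexFree-app-Neutral (mu c)    N rf = ⊥-elim (rf hole _ (μ-redex c N) refl)
RedexFree-app-Neutral (app M₁ M₂) N rf =
  app (RedexFree-app-Neutral M₁ M₂ λ C R r e → rf (appL C N) R r (cong (λ t → app t N) e))

Leftmost-appR : ∀ {M C} → Leftmost (appR M C) → RedexFree M
Leftmost-appR {C = C} lm C₁ R r e = lm (hole , C₁ , C , R , r , cong (λ t → appR t C) (sym e))

Outermost-appR : ∀ M {C R} → Outermost (appR M C) R → RedexFree M → Neutral M
Outermost-appR (var x)   om rf = var
Outermost-appR (lam P) {C} om rf = ⊥-elim (om (hole , appR (lam P) C , (λ ()) , refl , β-redex P _))
Outermost-appR (mu c)  {C} om rf = ⊥-elim (om (hole , appR (mu c) C , (λ ()) , refl , μ-redex c _))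
Outermost-appR (app M N) om rf = RedexFree-app-Neutral M N rf

LorCtx-of : ∀ C {R} → Outermost C R → Leftmost C → LorCtx C
LorCtx-of hole       om lm = hole
LorCtx-of (lamC C)   om lm = lamC (LorCtx-of C (Outermost-∘ (lamC hole) om) (Leftmost-∘ (lamC hole) lm))
LorCtx-of (muC b C)  om lm = muC (LorCtx-of C (Outermost-∘ (muC b hole) om) (Leftmost-∘ (muC b hole) lm))
LorCtx-of (appL C N) om lm =
  appL (Outermost-appL C om) (LorCtx-of C (Outermost-∘ (appL hole N) om) (Leftmost-∘ (appL hole N) lm))
LorCtx-of (appR M C) om lm =
  appR (Outermost-appR M om (Leftmost-appR lm))
       (LorCtx-of C (Outermost-∘ (appR M hole) om) (Leftmost-∘ (appR M hole) lm))

-- The expansion works for every type δ₁.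
lemma2p23 : ∀ (M N R Q : Term) (C : Ctx) (N₀ : Term) →
    LeftmostOutermost M C (app R Q) → app R Q ▷ N₀ → N ≡ plug C N₀ →
    ∀ (Γ₁ Γ₂ : Basis) (Δ₁ Δ₂ : NameCtx) (δ₁ δ₂ : TType) →
    Γ₁ ⊢ N ∶ δ₁ ∣ Δ₁ → NotIntersection δ₁ → Γ₂ ⊢ Q ∶ δ₂ ∣ Δ₂ →
    Σ Basis λ Γ₃ → Σ NameCtx λ Δ₃ → Σ TType λ δ₃ →
      (Γ₃ ≤Γ Γ₁) × (Δ₃ ≤Δ Δ₁) × (δ₁ ≤t δ₃) × (Γ₃ ⊢ M ∶ δ₃ ∣ Δ₃)
lemma2p23 M N R Q C N₀ lor contraction refl Γ₁ Γ₂ Δ₁ Δ₂ δ₁ δ₂ ⊢N _ ⊢Q =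
  let expansion Γ₃ Δ₃ δ₃ Γ₃≤Γ₁ Δ₃≤Δ₁ δ₁⊑δ₃ _ ⊢plug =
        ⊢-plug-expand (⊢-redex-expand contraction ⊢Q) (LorCtx-of C outermost leftmost) ⊢N
  in Γ₃ , Δ₃ , δ₃ , Γ≤.lookup-≤ Γ₃≤Γ₁ , Δ≤.lookup-≤ Δ₃≤Δ₁ , ⊑⇒≤ δ₁⊑δ₃ ,
     subst (λ t → Γ₃ ⊢ t ∶ δ₃ ∣ Δ₃) occurs ⊢plug
  where open LeftmostOutermost lor
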